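{- Let $P$ and $Q$ be Laurent polynomials in $x_1,\ldots,x_r$ with integer coefficients and $p$ a prime, and suppose there exists $n_0>0$ such that $p\nmid\mathrm{ct}(P^{n_0})$. Then the sequence $b_n=\mathrm{ct}(P^nQ)\bmod p$ ($n\in\mathbb{N}$) is recurrent.
   Context: $\mathrm{ct}(Q)$ denotes the constant term of a Laurent polynomial $Q$. A sequence $(s_n)$ is recurrent if for every occurrence of a word $w=s_is_{i+1}\cdots s_{i+\ell-1}$ there is a later occurrence, i.e. some $j>0$ with $w=s_{i+j}\cdots s_{i+j+\ell-1}$. -}

module Defs where

open import Data.Nat as ℕ using (ℕ; zero; suc; _<_)
open import Data.Integer as ℤ using (ℤ; +_; 0ℤ)
open import Data.Integer.DivMod using (_%ℕ_)
open import Data.Nat.Primality using (Prime; prime⇒nonZero)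
open import Data.Vec as Vec using (Vec; replicate; zipWith)
open import Data.List as List using (List; []; _∷_; concatMap; map; sum)
open import Data.Product using (_×_; _,_; Σ; ∃-syntax)
open import Relation.Binary.PropositionalEquality using (_≡_)
open import Relation.Nullary using (Dec; yes; no)
open import Data.Vec.Properties using () renaming (≡-dec to vec≡-dec)

-- A Laurent polynomial in r variables with integer coefficients, represented
-- as a finite formal sum of monomials  c · x^e  with c ∈ ℤ and exponent
-- vector e ∈ ℤ^r.  (Repeated exponents are allowed; they simply add up.)
Monomial : ℕ → Set
Monomial r = ℤ × Vec ℤ r

Laurent : ℕ → Set
Laurent r = List (Monomial r)

one : ∀ {r} → Laurent r
one = (+ 1 , replicate _ 0ℤ) ∷ []

_·_ : ∀ {r} → Laurent r → Laurent r → Laurent r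
P · Q = concatMap (λ { (a , e) → map (λ { (b , f) → (a ℤ.* b , zipWith ℤ._+_ e f) }) Q }) P

_^_ : ∀ {r} → Laurent r → ℕ → Laurent r
P ^ zero  = one
P ^ suc n = P · (P ^ n)

ct : ∀ {r} → Laurent r → ℤ
ct [] = 0ℤ
ct {r} ((c , e) ∷ P) with vec≡-dec ℤ._≟_ e (replicate r 0ℤ)
... | yes _ = c ℤ.+ ct P
... | no  _ = ct P

modPrime : ℤ → (p : ℕ) → Prime p → ℕ
modPrime x p pr = _%ℕ_ x p {{prime⇒nonZero pr}}

Recurrent : {A : Set} → (ℕ → A) → Set
Recurrent s = ∀ (i ℓ : ℕ) → ∃[ j ] (0 < j × (∀ k → k < ℓ → s (i ℕ.+ k) ≡ s (i ℕ.+ j ℕ.+ k)))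

-- Work modulo p, comparing Laurent polynomials A, B through all pairings ct(A·C).  In
-- characteristic p, Frobenius gives A^(p^k) ≡ A(x₁^(p^k), …, x_r^(p^k)), so
-- P^(n + m·p^k)·Q ≡ (P^n·Q)·P^m(x^(p^k)).  Once p^k exceeds the exponents of P^n·Q, a term of
-- P^n·Q times a term of P^m(x^(p^k)) is constant only when both are, hence
-- ct(P^(n + m·p^k)·Q) ≡ ct(P^n·Q)·ct(P^m).  Iterating with Q = 1 from c = ct(P^n₀) ≢ 0 gives
-- m > 0 with ct(P^m) ≡ c^(p-1) ≡ 1 (Fermat, itself Frobenius on constants), so every window
-- b_i … b_(i+ℓ-1) recurs at shift m·p^k once p^k bounds the exponents of P^n·Q for n < i + ℓ.
module Submission where

open import Algebra.Bundles using (CommutativeSemiring)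
open import Data.Nat using (ℕ)
open import Data.Nat.Primality using (Prime)

module BinomialCoefficients where
  open import Data.Nat
  open import Data.Nat.Properties
  open import Data.Nat.Divisibility
  open import Data.Nat.Primality
  open import Data.Nat.Combinatorics
  open import Data.Sum using (inj₁; inj₂)
  open import Relation.Nullary using (¬_; contradiction)
  open import Relation.Binary.PropositionalEquality

  prime∤! : ∀ {p m} → Prime p → m < p → ¬ p ∣ m !
  prime∤! {m = zero}  pr@(prime _) _   p∣1  = nonTrivial⇒≢1 (∣1⇒≡1 p∣1)
  prime∤! {m = suc m} pr           m<p p∣m! with euclidsLemma (suc m) (m !) pr p∣m!
  ... | inj₁ p∣1+m = <⇒≱ m<p (∣⇒≤ p∣1+m)
  ... | inj₂ p∣m!  = prime∤! pr (<-trans (n<1+n m) m<p) p∣m!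

  prime∣binomial : ∀ {p k} → Prime p → 0 < k → k < p → p ∣ p C k
  prime∣binomial {p@(suc q)} {k} pr 0<k k<p
    with euclidsLemma (p C k) (k ! * (p ∸ k) !) pr p∣pCk*k![p∸k]!
    where
      instance _ = k !* (p ∸ k) !≢0
      k≤p = <⇒≤ k<p
      k![p∸k]!∣p! = k![n∸k]!∣n! k≤p
      p!≡pCk*k![p∸k]! : p ! ≡ (p C k) * (k ! * (p ∸ k) !)
      p!≡pCk*k![p∸k]! = trans (m∣n⇒n≡quotient*m k![p∸k]!∣p!) (cong (_* (k ! * (p ∸ k) !))
        (sym (trans (nCk≡n!/k![n-k]! k≤p) (n/m≡quotient k![p∸k]!∣p!))))
      p∣pCk*k![p∸k]! : p ∣ (p C k) * (k ! * (p ∸ k) !)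
      p∣pCk*k![p∸k]! = subst (p ∣_) p!≡pCk*k![p∸k]! (m∣m*n (q !))
  ... | inj₁ p∣pCk = p∣pCk
  ... | inj₂ p∣k!*[p∸k]! with euclidsLemma (k !) ((p ∸ k) !) pr p∣k!*[p∸k]!
  ...   | inj₁ p∣k!     = contradiction p∣k! (prime∤! pr k<p)
  ...   | inj₂ p∣[p∸k]! = contradiction p∣[p∸k]! (prime∤! pr (∸-monoʳ-< 0<k (<⇒≤ k<p)))

module FreshmansDream {a ℓ} (S : CommutativeSemiring a ℓ) where
  open import Level using (_⊔_)
  open CommutativeSemiring S
  open import Algebra.Properties.CommutativeSemiring.Binomial S using (theorem; binomialTerm)
  open import Algebra.Properties.Semiring.Exp semiring using (_^_)
  open import Algebra.Properties.Semiring.Mult semiring using (_×_; ×-homo-1; ×-assocˡ)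
  open import Algebra.Properties.Monoid.Sum +-monoid
    using (sum; sum-cong-≋; sum-replicate-zero; sum-init-last)
  open import Data.Nat as ℕ using (ℕ; zero; suc; _∸_; s≤s; z≤n)
  import Data.Nat.Properties as ℕ
  open import Data.Nat.Primality using (Prime; ¬prime[0])
  open import Data.Nat.Divisibility using (divides)
  open import Data.Nat.Combinatorics using (_C_; nCn≡1)
  open import Data.Fin as Fin using (Fin; toℕ; fromℕ; inject₁)
  open import Data.Fin.Properties using (toℕ-fromℕ; toℕ-inject₁; toℕ<n)
  open import Data.Vec.Functional using (init)
  open import Data.Empty using (⊥-elim)
  open import Relation.Binary.PropositionalEquality as ≡ using (_≡_)
  open import Relation.Binary.Reasoning.Setoid setoid
  open BinomialCoefficients using (prime∣binomial)

  Characteristic : ℕ → Set (a ⊔ ℓ)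
  Characteristic p = ∀ x → p × x ≈ 0#

  frobenius-+ : ∀ {p} → Prime p → Characteristic p → ∀ x y → (x + y) ^ p ≈ x ^ p + y ^ p
  frobenius-+ {zero}      pr _    _ _ = ⊥-elim (¬prime[0] pr)
  frobenius-+ {p@(suc q)} pr char x y = begin
    (x + y) ^ p                                    ≈⟨ theorem p x y ⟩
    term Fin.zero + sum inner                      ≈⟨ +-cong first (sum-init-last inner) ⟩
    y ^ p + (sum (init inner) + inner (fromℕ q))   ≈⟨ +-congˡ (+-cong middle last) ⟩
    y ^ p + (0# + x ^ p)                           ≈⟨ +-congˡ (+-identityˡ _) ⟩
    y ^ p + x ^ p                                  ≈⟨ +-comm _ _ ⟩
    x ^ p + y ^ p                                  ∎
    where
      term = binomialTerm x y p

      inner : Fin p → Carrier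
      inner i = term (Fin.suc i)

      term≡ : ∀ i {k} → toℕ i ≡ k → term i ≡ (p C k) × (x ^ k * y ^ (p ∸ k))
      term≡ i = ≡.cong (λ k → (p C k) × (x ^ k * y ^ (p ∸ k)))

      first : term Fin.zero ≈ y ^ p
      first = trans (×-homo-1 _) (*-identityˡ _)

      last : inner (fromℕ q) ≈ x ^ p
      last = begin
        inner (fromℕ q)                   ≡⟨ term≡ (Fin.suc (fromℕ q)) (≡.cong suc (toℕ-fromℕ q)) ⟩
        (p C p) × (x ^ p * y ^ (p ∸ p))   ≡⟨ ≡.cong₂ (λ c k → c × (x ^ p * y ^ k)) (nCn≡1 p) (ℕ.n∸n≡0 p) ⟩
        1 × (x ^ p * 1#)                  ≈⟨ ×-homo-1 _ ⟩
        x ^ p * 1#                        ≈⟨ *-identityʳ _ ⟩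
        x ^ p                             ∎

      vanishes : ∀ (i : Fin q) → init inner i ≈ 0#
      vanishes i with prime∣binomial pr (s≤s z≤n) (s≤s (toℕ<n i))
      ... | divides c pCk≡c*p = begin
        init inner i                 ≡⟨ term≡ (Fin.suc (inject₁ i)) (≡.cong suc (toℕ-inject₁ i)) ⟩
        (p C k) × z                  ≡⟨ ≡.cong (_× z) (≡.trans pCk≡c*p (ℕ.*-comm c p)) ⟩
        (p ℕ.* c) × z                ≈⟨ ×-assocˡ z p c ⟨
        p × (c × z)                  ≈⟨ char (c × z) ⟩
        0#                           ∎
        where
          k = suc (toℕ i)
          z = x ^ k * y ^ (p ∸ k)

      middle : sum (init inner) ≈ 0#
      middle = trans (sum-cong-≋ vanishes) (sum-replicate-zero q)

  frobenius-× : ∀ {p} → Prime p → Characteristic p → ∀ n x → (n × x) ^ p ≈ n × x ^ p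
  frobenius-× {zero}  pr _    _       _ = ⊥-elim (¬prime[0] pr)
  frobenius-× {suc _} _  _    zero    _ = zeroˡ _
  frobenius-× {suc _} pr char (suc n) x =
    trans (frobenius-+ pr char x (n × x)) (+-congˡ (frobenius-× pr char n x))

module IntegerCongruence where
  open import Level using (0ℓ)
  open import Data.Nat as ℕ using (ℕ; zero; suc; NonZero)
  import Data.Nat.Properties as ℕ
  import Data.Nat.Divisibility as ℕ
  open import Data.Nat.Primality using (Prime; euclidsLemma)
  open import Data.Integer using (ℤ; +_; 0ℤ; _+_; _-_; _*_; -_; ∣_∣; _%ℕ_; _/ℕ_)
  import Data.Integer.Properties as ℤ
  open import Data.Integer.DivMod using (a≡a%ℕn+[a/ℕn]*n; n%ℕd<d)
  open import Data.Integer.Divisibility.Signed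
  open import Data.Integer.Tactic.RingSolver using (solve-∀)
  open import Data.Sum using (_⊎_; inj₁; inj₂; map)
  open import Relation.Nullary using (¬_; contradiction)
  open import Relation.Binary.PropositionalEquality
  open import Relation.Binary.Bundles using (Setoid)
  import Relation.Binary.Reasoning.Setoid

  infix 4 _≡_mod_
  record _≡_mod_ (x y : ℤ) (m : ℕ) : Set where
    constructor ≡-mod
    field divides-difference : + m ∣ x - y

  private variable
    m : ℕ
    x y z u v : ℤ

  ≡-mod-reflexive : x ≡ y → x ≡ y mod m
  ≡-mod-reflexive {x} refl = ≡-mod (divides 0ℤ (ℤ.+-inverseʳ x))

  ≡-mod-sym : x ≡ y mod m → y ≡ x mod m
  ≡-mod-sym {x} {y} (≡-mod m∣x-y) = ≡-mod (subst (_ ∣_) (lemma x y) (∣m⇒∣-m m∣x-y))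
    where lemma : ∀ x y → - (x - y) ≡ y - x
          lemma = solve-∀

  ≡-mod-trans : x ≡ y mod m → y ≡ z mod m → x ≡ z mod m
  ≡-mod-trans {x = x} {y} {z = z} (≡-mod m∣x-y) (≡-mod m∣y-z) =
    ≡-mod (subst (_ ∣_) (lemma x y z) (∣m∣n⇒∣m+n m∣x-y m∣y-z))
    where lemma : ∀ x y z → (x - y) + (y - z) ≡ x - z
          lemma = solve-∀

  ≡-mod-setoid : ℕ → Setoid 0ℓ 0ℓ
  ≡-mod-setoid m = record
    { Carrier       = ℤ
    ; _≈_           = λ x y → x ≡ y mod m
    ; isEquivalence = record { refl = ≡-mod-reflexive refl ; sym = ≡-mod-sym ; trans = ≡-mod-trans }
    }

  module ≡-mod-Reasoning (m : ℕ) = Relation.Binary.Reasoning.Setoid (≡-mod-setoid m)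

  +-cong-mod : x ≡ y mod m → u ≡ v mod m → x + u ≡ y + v mod m
  +-cong-mod {x = x} {y} {u = u} {v} (≡-mod m∣x-y) (≡-mod m∣u-v) =
    ≡-mod (subst (_ ∣_) (lemma x y u v) (∣m∣n⇒∣m+n m∣x-y m∣u-v))
    where lemma : ∀ x y u v → (x - y) + (u - v) ≡ (x + u) - (y + v)
          lemma = solve-∀

  *-congˡ-mod : ∀ c → x ≡ y mod m → c * x ≡ c * y mod m
  *-congˡ-mod {x} {y} c (≡-mod m∣x-y) = ≡-mod (subst (_ ∣_) (lemma c x y) (∣n⇒∣m*n c m∣x-y))
    where lemma : ∀ c x y → c * (x - y) ≡ c * x - c * y
          lemma = solve-∀

  *-congʳ-mod : ∀ c → x ≡ y mod m → x * c ≡ y * c mod m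
  *-congʳ-mod {x} {y} c x≡y =
    subst₂ (λ a b → a ≡ b mod _) (ℤ.*-comm c x) (ℤ.*-comm c y) (*-congˡ-mod c x≡y)

  m*x≡0-mod : ∀ x → + m * x ≡ 0ℤ mod m
  m*x≡0-mod {m} x = ≡-mod (divides x (lemma (+ m) x))
    where lemma : ∀ m x → m * x - 0ℤ ≡ x * m
          lemma = solve-∀

  ≡-mod-%ℕ : ∀ x .{{_ : NonZero m}} → x ≡ + (x %ℕ m) mod m
  ≡-mod-%ℕ {m} x = ≡-mod (divides (x /ℕ m) (begin
    x - r                      ≡⟨ cong (_- r) (a≡a%ℕn+[a/ℕn]*n x m) ⟩
    r + (x /ℕ m) * + m - r     ≡⟨ lemma r ((x /ℕ m) * + m) ⟩
    (x /ℕ m) * + m             ∎))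
    where
      open ≡-Reasoning
      r = + (x %ℕ m)
      lemma : ∀ r q → r + q - r ≡ q
      lemma = solve-∀

  ∣∧<⇒≡0 : ∀ {d n} → d ℕ.∣ n → n ℕ.< d → n ≡ 0
  ∣∧<⇒≡0 {n = zero}  _   _   = refl
  ∣∧<⇒≡0 {n = suc _} d∣n n<d = contradiction d∣n (ℕ.>⇒∤ n<d)

  residue-unique-≤ : ∀ {a b} → a ℕ.≤ b → b ℕ.< m → + a ≡ + b mod m → a ≡ b
  residue-unique-≤ {m} {a} {b} a≤b b<m (≡-mod m∣a-b) = ℕ.≤-antisym a≤b (ℕ.m∸n≡0⇒m≤n b∸a≡0)
    where
      m∣b∸a : m ℕ.∣ b ℕ.∸ a
      m∣b∸a = subst (m ℕ.∣_) (trans (cong ∣_∣ (ℤ.[+m]-[+n]≡m⊖n a b)) (ℤ.∣⊖∣-≤ a≤b)) (∣⇒∣ᵤ m∣a-b)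
      b∸a≡0 : b ℕ.∸ a ≡ 0
      b∸a≡0 = ∣∧<⇒≡0 m∣b∸a (ℕ.≤-<-trans (ℕ.m∸n≤m b a) b<m)

  residue-unique : ∀ {a b} → a ℕ.< m → b ℕ.< m → + a ≡ + b mod m → a ≡ b
  residue-unique {a = a} {b} a<m b<m a≡b with ℕ.≤-total a b
  ... | inj₁ a≤b = residue-unique-≤ a≤b b<m a≡b
  ... | inj₂ b≤a = sym (residue-unique-≤ b≤a a<m (≡-mod-sym a≡b))

  %ℕ-cong : .{{_ : NonZero m}} → x ≡ y mod m → x %ℕ m ≡ y %ℕ m
  %ℕ-cong {m} {x} {y} x≡y = residue-unique (n%ℕd<d x m) (n%ℕd<d y m)
    (≡-mod-trans (≡-mod-sym (≡-mod-%ℕ x)) (≡-mod-trans x≡y (≡-mod-%ℕ y)))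

  euclidsLemma-ℤ : ∀ {p} → Prime p → (+ p ∣ x * y) → (+ p ∣ x) ⊎ (+ p ∣ y)
  euclidsLemma-ℤ {x = x} {y} pr p∣xy = map ∣ᵤ⇒∣ ∣ᵤ⇒∣
    (euclidsLemma ∣ x ∣ ∣ y ∣ pr (subst (ℕ._∣_ _) (ℤ.abs-* x y) (∣⇒∣ᵤ p∣xy)))

  prime-*-cancelˡ : ∀ {p c} → Prime p → ¬ (+ p ∣ c) → c * x ≡ c * y mod p → x ≡ y mod p
  prime-*-cancelˡ {x = x} {y} {c = c} pr p∤c (≡-mod p∣cx-cy)
    with euclidsLemma-ℤ pr (subst (_ ∣_) (lemma c x y) p∣cx-cy)
    where lemma : ∀ c x y → c * x - c * y ≡ c * (x - y)
          lemma = solve-∀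
  ... | inj₁ p∣c   = contradiction p∣c p∤c
  ... | inj₂ p∣x-y = ≡-mod p∣x-y

module NatBounds where
  open import Data.Nat
  open import Data.Nat.Properties
  open import Data.Sum using (inj₁; inj₂)
  open import Relation.Binary.PropositionalEquality using (refl; subst)

  supBelow : (ℕ → ℕ) → ℕ → ℕ
  supBelow f zero    = 0
  supBelow f (suc N) = f N ⊔ supBelow f N

  ≤-supBelow : ∀ f {n N} → n < N → f n ≤ supBelow f N
  ≤-supBelow f {n} {suc N} n<1+N with m≤n⇒m<n∨m≡n (s≤s⁻¹ n<1+N)
  ... | inj₁ n<N  = ≤-trans (≤-supBelow f n<N) (m≤n⊔m (f N) _)
  ... | inj₂ refl = m≤m⊔n (f n) _

  n<m^n : ∀ {m} → 1 < m → ∀ n → n < m ^ n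
  n<m^n     1<m zero    = s≤s z≤n
  n<m^n {m} 1<m (suc n) =
    ≤-<-trans (n<m^n 1<m n) (subst (m ^ n <_) (*-comm (m ^ n) m) (m<m*n (m ^ n) m 1<m))
    where instance
      _ = >-nonZero (<-trans z<s 1<m)
      _ = m^n≢0 m n

open import Defs

module FormalSums where
  open import Data.Nat using (ℕ)
  open import Data.Integer using (ℤ; +_; 0ℤ; _+_; _*_)
  import Data.Integer.Properties as ℤ
  open import Data.Integer.Tactic.RingSolver using (solve-∀)
  open import Data.Vec as Vec using (Vec; replicate; zipWith)
  import Data.Vec.Properties as Vec
  open import Data.List as List using ([]; _∷_; _++_; concatMap)
  open import Data.Product using (_,_)
  open import Relation.Nullary using (yes; no; contradiction)
  open import Relation.Binary.PropositionalEquality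
  open ≡-Reasoning

  private variable
    r : ℕ

  0ᵥ : Vec ℤ r
  0ᵥ = replicate _ 0ℤ

  1ₘ : Monomial r
  1ₘ = + 1 , 0ᵥ

  infixl 7 _⊗_
  _⊗_ : Monomial r → Monomial r → Monomial r
  (a , e) ⊗ (b , f) = a * b , zipWith _+_ e f

  ⊗-comm : ∀ (a b : Monomial r) → a ⊗ b ≡ b ⊗ a
  ⊗-comm (a , e) (b , f) = cong₂ _,_ (ℤ.*-comm a b) (Vec.zipWith-comm ℤ.+-comm e f)

  ⊗-assoc : ∀ (a b c : Monomial r) → (a ⊗ b) ⊗ c ≡ a ⊗ (b ⊗ c)
  ⊗-assoc (a , e) (b , f) (c , g) = cong₂ _,_ (ℤ.*-assoc a b c) (Vec.zipWith-assoc ℤ.+-assoc e f g)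

  ⊗-identityˡ : ∀ (a : Monomial r) → 1ₘ ⊗ a ≡ a
  ⊗-identityˡ (a , e) = cong₂ _,_ (ℤ.*-identityˡ a) (Vec.zipWith-identityˡ ℤ.+-identityˡ e)

  ctₘ : Monomial r → ℤ
  ctₘ (c , e) with Vec.≡-dec ℤ._≟_ e 0ᵥ
  ... | yes _ = c
  ... | no  _ = 0ℤ

  ctₘ-≢0ᵥ : ∀ c {e : Vec ℤ r} → e ≢ 0ᵥ → ctₘ (c , e) ≡ 0ℤ
  ctₘ-≢0ᵥ c {e} e≢0 with Vec.≡-dec ℤ._≟_ e 0ᵥ
  ... | yes e≡0 = contradiction e≡0 e≢0
  ... | no  _   = refl

  ctₘ-*ˡ : ∀ a b (e : Vec ℤ r) → ctₘ (a * b , e) ≡ a * ctₘ (b , e)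
  ctₘ-*ˡ a b e with Vec.≡-dec ℤ._≟_ e 0ᵥ
  ... | yes _ = refl
  ... | no  _ = sym (ℤ.*-zeroʳ a)

  ∑ : Laurent r → (Monomial r → ℤ) → ℤ
  ∑ []      g = 0ℤ
  ∑ (a ∷ A) g = g a + ∑ A g

  ct≡∑ctₘ : ∀ (A : Laurent r) → ct A ≡ ∑ A ctₘ
  ct≡∑ctₘ []            = refl
  ct≡∑ctₘ ((c , e) ∷ A) with Vec.≡-dec ℤ._≟_ e 0ᵥ
  ... | yes _ = cong (_+_ c) (ct≡∑ctₘ A)
  ... | no  _ = trans (ct≡∑ctₘ A) (sym (ℤ.+-identityˡ _))

  ∑-cong : ∀ (A : Laurent r) {g h : Monomial r → ℤ} → (∀ a → g a ≡ h a) → ∑ A g ≡ ∑ A h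
  ∑-cong []      g≗h = refl
  ∑-cong (a ∷ A) g≗h = cong₂ _+_ (g≗h a) (∑-cong A g≗h)

  ∑-++ : ∀ (A B : Laurent r) (g : Monomial r → ℤ) → ∑ (A ++ B) g ≡ ∑ A g + ∑ B g
  ∑-++ []      B g = sym (ℤ.+-identityˡ _)
  ∑-++ (a ∷ A) B g = trans (cong (_+_ (g a)) (∑-++ A B g)) (sym (ℤ.+-assoc (g a) _ _))

  ∑-map : ∀ (A : Laurent r) (f : Monomial r → Monomial r) (g : Monomial r → ℤ) →
          ∑ (List.map f A) g ≡ ∑ A (λ a → g (f a))
  ∑-map []      f g = refl
  ∑-map (a ∷ A) f g = cong (_+_ (g (f a))) (∑-map A f g)

  ∑-concatMap : ∀ (A : Laurent r) (f : Monomial r → Laurent r) (g : Monomial r → ℤ) →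
                ∑ (concatMap f A) g ≡ ∑ A (λ a → ∑ (f a) g)
  ∑-concatMap []      f g = refl
  ∑-concatMap (a ∷ A) f g = trans (∑-++ (f a) _ g) (cong (_+_ (∑ (f a) g)) (∑-concatMap A f g))

  ∑-zero : ∀ (A : Laurent r) → ∑ A (λ _ → 0ℤ) ≡ 0ℤ
  ∑-zero []      = refl
  ∑-zero (a ∷ A) = trans (ℤ.+-identityˡ _) (∑-zero A)

  ∑-distrib-+ : ∀ (A : Laurent r) (g h : Monomial r → ℤ) → ∑ A (λ a → g a + h a) ≡ ∑ A g + ∑ A h
  ∑-distrib-+ []      g h = refl
  ∑-distrib-+ (a ∷ A) g h =
    trans (cong (_+_ (g a + h a)) (∑-distrib-+ A g h)) (interchange (g a) (h a) (∑ A g) (∑ A h))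
    where interchange : ∀ w x y z → w + x + (y + z) ≡ w + y + (x + z)
          interchange = solve-∀

  ∑-*ˡ : ∀ (A : Laurent r) c (g : Monomial r → ℤ) → ∑ A (λ a → c * g a) ≡ c * ∑ A g
  ∑-*ˡ []      c g = sym (ℤ.*-zeroʳ c)
  ∑-*ˡ (a ∷ A) c g = trans (cong (_+_ (c * g a)) (∑-*ˡ A c g)) (sym (ℤ.*-distribˡ-+ c (g a) _))

  ∑-comm : ∀ (A B : Laurent r) (g : Monomial r → Monomial r → ℤ) →
           ∑ A (λ a → ∑ B (g a)) ≡ ∑ B (λ b → ∑ A (λ a → g a b))
  ∑-comm []      B g = sym (∑-zero B)
  ∑-comm (a ∷ A) B g = trans (cong (_+_ (∑ B (g a))) (∑-comm A B g))
                             (sym (∑-distrib-+ B (g a) (λ b → ∑ A (λ a → g a b))))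

  ∑-· : ∀ (A B : Laurent r) (g : Monomial r → ℤ) → ∑ (A · B) g ≡ ∑ A (λ a → ∑ B (λ b → g (a ⊗ b)))
  ∑-· A B g = trans (∑-concatMap A (λ a → List.map (a ⊗_) B) g) (∑-cong A (λ a → ∑-map B (a ⊗_) g))

  -- Equality of formal sums up to the order of their terms, detected by weighted counts.
  infix 4 _≋_
  record _≋_ (A B : Laurent r) : Set where
    constructor ≋-∑
    field ∑-≡ : ∀ g → ∑ A g ≡ ∑ B g
  open _≋_ public

  ≋-sym : ∀ {A B : Laurent r} → A ≋ B → B ≋ A
  ≋-sym A≋B = ≋-∑ λ g → sym (∑-≡ A≋B g)

  ≋-trans : ∀ {A B C : Laurent r} → A ≋ B → B ≋ C → A ≋ C
  ≋-trans A≋B B≋C = ≋-∑ λ g → trans (∑-≡ A≋B g) (∑-≡ B≋C g)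

  ct-cong-≋ : ∀ {A B : Laurent r} → A ≋ B → ct A ≡ ct B
  ct-cong-≋ {A = A} {B} A≋B = trans (ct≡∑ctₘ A) (trans (∑-≡ A≋B ctₘ) (sym (ct≡∑ctₘ B)))

  ct-++ : ∀ (A B : Laurent r) → ct (A ++ B) ≡ ct A + ct B
  ct-++ A B = begin
    ct (A ++ B)          ≡⟨ ct≡∑ctₘ (A ++ B) ⟩
    ∑ (A ++ B) ctₘ       ≡⟨ ∑-++ A B ctₘ ⟩
    ∑ A ctₘ + ∑ B ctₘ    ≡⟨ cong₂ _+_ (ct≡∑ctₘ A) (ct≡∑ctₘ B) ⟨
    ct A + ct B          ∎

  ≋-·ʳ : ∀ {A B : Laurent r} C → A ≋ B → A · C ≋ B · C
  ≋-·ʳ {A = A} {B} C A≋B = ≋-∑ λ g → trans (∑-· A C g) (trans (∑-≡ A≋B _) (sym (∑-· B C g)))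

  ++-comm-≋ : ∀ (A B : Laurent r) → A ++ B ≋ B ++ A
  ++-comm-≋ A B = ≋-∑ λ g → trans (∑-++ A B g) (trans (ℤ.+-comm (∑ A g) (∑ B g)) (sym (∑-++ B A g)))

  ·-assoc-≋ : ∀ (A B C : Laurent r) → (A · B) · C ≋ A · (B · C)
  ·-assoc-≋ A B C = ≋-∑ λ g → begin
    ∑ ((A · B) · C) g                                    ≡⟨ ∑-· (A · B) C g ⟩
    ∑ (A · B) (λ ab → ∑ C (λ c → g (ab ⊗ c)))            ≡⟨ ∑-· A B _ ⟩
    ∑ A (λ a → ∑ B (λ b → ∑ C (λ c → g ((a ⊗ b) ⊗ c))))
      ≡⟨ ∑-cong A (λ a → ∑-cong B (λ b → ∑-cong C (λ c → cong g (⊗-assoc a b c)))) ⟩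
    ∑ A (λ a → ∑ B (λ b → ∑ C (λ c → g (a ⊗ (b ⊗ c)))))
      ≡⟨ ∑-cong A (λ a → ∑-· B C (λ bc → g (a ⊗ bc))) ⟨
    ∑ A (λ a → ∑ (B · C) (λ bc → g (a ⊗ bc)))            ≡⟨ ∑-· A (B · C) g ⟨
    ∑ (A · (B · C)) g                                    ∎

  ·-comm-≋ : ∀ (A B : Laurent r) → A · B ≋ B · A
  ·-comm-≋ A B = ≋-∑ λ g → begin
    ∑ (A · B) g                           ≡⟨ ∑-· A B g ⟩
    ∑ A (λ a → ∑ B (λ b → g (a ⊗ b)))     ≡⟨ ∑-comm A B _ ⟩
    ∑ B (λ b → ∑ A (λ a → g (a ⊗ b)))     ≡⟨ ∑-cong B (λ b → ∑-cong A (λ a → cong g (⊗-comm a b))) ⟩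
    ∑ B (λ b → ∑ A (λ a → g (b ⊗ a)))     ≡⟨ ∑-· B A g ⟨
    ∑ (B · A) g                           ∎

  ·-identityˡ-≋ : ∀ (A : Laurent r) → one · A ≋ A
  ·-identityˡ-≋ A = ≋-∑ λ g → begin
    ∑ (one · A) g                     ≡⟨ ∑-· one A g ⟩
    ∑ A (λ a → g (1ₘ ⊗ a)) + 0ℤ       ≡⟨ ℤ.+-identityʳ _ ⟩
    ∑ A (λ a → g (1ₘ ⊗ a))            ≡⟨ ∑-cong A (λ a → cong g (⊗-identityˡ a)) ⟩
    ∑ A g                             ∎

  ·-identityʳ-≋ : ∀ (A : Laurent r) → A · one ≋ A
  ·-identityʳ-≋ A = ≋-trans (·-comm-≋ A one) (·-identityˡ-≋ A)

  ·-distribʳ-≋ : ∀ (A B C : Laurent r) → (B ++ C) · A ≋ B · A ++ C · A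
  ·-distribʳ-≋ A B C = ≋-∑ λ g → begin
    ∑ ((B ++ C) · A) g                                                       ≡⟨ ∑-· (B ++ C) A g ⟩
    ∑ (B ++ C) (λ b → ∑ A (λ a → g (b ⊗ a)))                                 ≡⟨ ∑-++ B C _ ⟩
    ∑ B (λ b → ∑ A (λ a → g (b ⊗ a))) + ∑ C (λ c → ∑ A (λ a → g (c ⊗ a)))
      ≡⟨ cong₂ _+_ (∑-· B A g) (∑-· C A g) ⟨
    ∑ (B · A) g + ∑ (C · A) g                                                ≡⟨ ∑-++ (B · A) (C · A) g ⟨
    ∑ (B · A ++ C · A) g                                                     ∎

module LaurentModP where
  open import Level using (0ℓ)
  open import Data.Integer using (_+_)
  open import Data.List using ([]; _++_)
  import Data.List.Properties as List
  open import Relation.Binary.PropositionalEquality using (_≡_; refl; trans)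
  open import Relation.Binary.Structures using (IsEquivalence)
  open FormalSums
  open IntegerCongruence

  private variable
    r p : ℕ
    A B C : Laurent r

  -- Testing against every C (in particular every monomial x^(-e)) amounts to coefficientwise
  -- congruence, without ever normalising formal sums.
  infix 4 _≈_mod_
  record _≈_mod_ (A B : Laurent r) (p : ℕ) : Set where
    constructor ≈-mod
    field ct-·-≡ : ∀ C → ct (A · C) ≡ ct (B · C) mod p
  open _≈_mod_ public

  ≈-refl : A ≈ A mod p
  ≈-refl = ≈-mod (λ C → ≡-mod-reflexive refl)

  ≈-sym : A ≈ B mod p → B ≈ A mod p
  ≈-sym A≈B = ≈-mod (λ C → ≡-mod-sym (ct-·-≡ A≈B C))

  ≈-trans : A ≈ B mod p → B ≈ C mod p → A ≈ C mod p
  ≈-trans A≈B B≈C = ≈-mod (λ C → ≡-mod-trans (ct-·-≡ A≈B C) (ct-·-≡ B≈C C))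

  ≡⇒≈ : A ≡ B → A ≈ B mod p
  ≡⇒≈ refl = ≈-refl

  ≋⇒≈ : A ≋ B → A ≈ B mod p
  ≋⇒≈ A≋B = ≈-mod (λ C → ≡-mod-reflexive (ct-cong-≋ (≋-·ʳ C A≋B)))

  ct-cong-≈ : A ≈ B mod p → ct A ≡ ct B mod p
  ct-cong-≈ {A = A} {B = B} {p = p} A≈B = begin
    ct A             ≡⟨ ct-cong-≋ (·-identityʳ-≋ A) ⟨
    ct (A · one)     ≈⟨ ct-·-≡ A≈B one ⟩
    ct (B · one)     ≡⟨ ct-cong-≋ (·-identityʳ-≋ B) ⟩
    ct B             ∎
    where open ≡-mod-Reasoning p

  ct-·-++ : ∀ (A B C : Laurent r) → ct ((A ++ B) · C) ≡ ct (A · C) + ct (B · C)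
  ct-·-++ A B C = trans (ct-cong-≋ (·-distribʳ-≋ C A B)) (ct-++ (A · C) (B · C))

  ++-cong-≈ : ∀ {p} {A B C D : Laurent r} → A ≈ B mod p → C ≈ D mod p → A ++ C ≈ B ++ D mod p
  ++-cong-≈ {p = p} {A} {B} {C} {D} A≈B C≈D = ≈-mod λ X → begin
    ct ((A ++ C) · X)          ≡⟨ ct-·-++ A C X ⟩
    ct (A · X) + ct (C · X)    ≈⟨ +-cong-mod (ct-·-≡ A≈B X) (ct-·-≡ C≈D X) ⟩
    ct (B · X) + ct (D · X)    ≡⟨ ct-·-++ B D X ⟨
    ct ((B ++ D) · X)          ∎
    where open ≡-mod-Reasoning p

  ·-cong-≈ : ∀ {p} {A B C D : Laurent r} → A ≈ B mod p → C ≈ D mod p → A · C ≈ B · D mod p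
  ·-cong-≈ {p = p} {A} {B} {C} {D} A≈B C≈D = ≈-mod λ X → begin
    ct ((A · C) · X)     ≡⟨ ct-cong-≋ (·-assoc-≋ A C X) ⟩
    ct (A · (C · X))     ≈⟨ ct-·-≡ A≈B (C · X) ⟩
    ct (B · (C · X))     ≡⟨ ct-cong-≋ (≋-trans (·-comm-≋ B (C · X)) (·-assoc-≋ C X B)) ⟩
    ct (C · (X · B))     ≈⟨ ct-·-≡ C≈D (X · B) ⟩
    ct (D · (X · B))     ≡⟨ ct-cong-≋ (≋-trans (≋-sym (·-assoc-≋ D X B)) (·-comm-≋ (D · X) B)) ⟩
    ct (B · (D · X))     ≡⟨ ct-cong-≋ (·-assoc-≋ B D X) ⟨
    ct ((B · D) · X)     ∎
    where open ≡-mod-Reasoning p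

  module _ (r p : ℕ) where
    open import Algebra.Structures.Biased {A = Laurent r} (λ A B → A ≈ B mod p)
      using (isCommutativeMonoidˡ; isCommutativeSemiringˡ)

    ≈-isEquivalence : IsEquivalence (λ (A B : Laurent r) → A ≈ B mod p)
    ≈-isEquivalence = record { refl = ≈-refl ; sym = ≈-sym ; trans = ≈-trans }

    laurentSemiring : CommutativeSemiring 0ℓ 0ℓ
    laurentSemiring = record
      { Carrier = Laurent r ; _≈_ = λ A B → A ≈ B mod p
      ; _+_ = _++_ ; _*_ = _·_ ; 0# = [] ; 1# = one
      ; isCommutativeSemiring = isCommutativeSemiringˡ record
        { +-isCommutativeMonoid = isCommutativeMonoidˡ record
          { isSemigroup = record
            { isMagma = record { isEquivalence = ≈-isEquivalence ; ∙-cong = ++-cong-≈ }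
            ; assoc   = λ A B C → ≡⇒≈ (List.++-assoc A B C) }
          ; identityˡ = λ A → ≈-refl
          ; comm      = λ A B → ≋⇒≈ (++-comm-≋ A B) }
        ; *-isCommutativeMonoid = isCommutativeMonoidˡ record
          { isSemigroup = record
            { isMagma = record { isEquivalence = ≈-isEquivalence ; ∙-cong = ·-cong-≈ }
            ; assoc   = λ A B C → ≋⇒≈ (·-assoc-≋ A B C) }
          ; identityˡ = λ A → ≋⇒≈ (·-identityˡ-≋ A)
          ; comm      = λ A B → ≋⇒≈ (·-comm-≋ A B) }
        ; distribʳ = λ A B C → ≋⇒≈ (·-distribʳ-≋ A B C)
        ; zeroˡ    = λ A → ≈-refl } }

module Dilation where
  open import Data.Nat as ℕ using (ℕ; zero; suc)
  import Data.Nat.Properties as ℕ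
  open import Data.Nat.ListAction using (sum)
  open import Data.Integer as ℤ using (ℤ; +_; 0ℤ; _+_; _*_; -_; ∣_∣)
  import Data.Integer.Properties as ℤ
  open import Data.Integer.Tactic.RingSolver using (solve-∀)
  open import Data.Vec as Vec using (Vec; []; _∷_; zipWith)
  import Data.Vec.Properties as Vec
  open import Data.List as List using ([]; _∷_)
  import Data.List.Properties as List
  open import Data.Product using (_,_; proj₂)
  open import Function using (_∘_)
  open import Relation.Nullary using (yes; no)
  open import Relation.Binary.PropositionalEquality
  open FormalSums

  private variable
    r n : ℕ

  dilateₘ : ℕ → Monomial r → Monomial r
  dilateₘ K (c , e) = c , Vec.map (+ K *_) e

  dilate : ℕ → Laurent r → Laurent r
  dilate K = List.map (dilateₘ K)

  dilate-1 : ∀ (A : Laurent r) → dilate 1 A ≡ A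
  dilate-1 A = trans (List.map-cong 1·m≡m A) (List.map-id A)
    where 1·m≡m : ∀ (m : Monomial r) → dilateₘ 1 m ≡ m
          1·m≡m (c , e) = cong (c ,_) (trans (Vec.map-cong ℤ.*-identityˡ e) (Vec.map-id e))

  dilate-dilate : ∀ a b (A : Laurent r) → dilate a (dilate b A) ≡ dilate (a ℕ.* b) A
  dilate-dilate a b A = trans (sym (List.map-∘ A)) (List.map-cong a·b·m≡ab·m A)
    where
      a*[b*x]≡ab*x : ∀ x → + a * (+ b * x) ≡ + (a ℕ.* b) * x
      a*[b*x]≡ab*x x = trans (sym (ℤ.*-assoc (+ a) (+ b) x)) (cong (_* x) (sym (ℤ.pos-* a b)))
      a·b·m≡ab·m : ∀ (m : Monomial r) → dilateₘ a (dilateₘ b m) ≡ dilateₘ (a ℕ.* b) m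
      a·b·m≡ab·m (c , e) = cong (c ,_) (trans (sym (Vec.map-∘ _ _ e)) (Vec.map-cong a*[b*x]≡ab*x e))

  e+k·e≡[1+k]·e : ∀ k (e : Vec ℤ n) → zipWith _+_ e (Vec.map (+ k *_) e) ≡ Vec.map (+ suc k *_) e
  e+k·e≡[1+k]·e k []      = refl
  e+k·e≡[1+k]·e k (x ∷ e) = cong₂ _∷_ (lemma (+ k) x) (e+k·e≡[1+k]·e k e)
    where lemma : ∀ a x → x + a * x ≡ (+ 1 + a) * x
          lemma = solve-∀

  monomial-^ : ∀ c (e : Vec ℤ r) n → ((c , e) ∷ []) ^ n ≡ dilate n ((c ℤ.^ n , e) ∷ [])
  monomial-^ c e zero    =
    cong (λ v → (+ 1 , v) ∷ []) (sym (trans (Vec.map-cong ℤ.*-zeroˡ e) (Vec.map-const e 0ℤ)))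
  monomial-^ c e (suc n) rewrite monomial-^ c e n =
    cong (λ v → (c * c ℤ.^ n , v) ∷ []) (e+k·e≡[1+k]·e n e)

  ∥_∥ : Vec ℤ n → ℕ
  ∥ e ∥ = Vec.sum (Vec.map ∣_∣ e)

  exponentSize : Laurent r → ℕ
  exponentSize A = sum (List.map (λ m → ∥ proj₂ m ∥) A)

  dilation-kernel : ∀ {K x y} → ∣ x ∣ ℕ.< K → x + + K * y ≡ 0ℤ → y ≡ 0ℤ
  dilation-kernel {K} {x} {y} ∣x∣<K x+Ky≡0 =
    ℤ.∣i∣≡0⇒i≡0 (ℕ.n<1⇒n≡0 (ℕ.*-cancelˡ-< K _ 1 K*∣y∣<K*1))
    where
      x≡-Ky : x ≡ - (+ K * y)
      x≡-Ky = trans (lemma x (+ K * y)) (trans (cong (_+ - (+ K * y)) x+Ky≡0) (ℤ.+-identityˡ _))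
        where lemma : ∀ x t → x ≡ x + t + - t
              lemma = solve-∀
      ∣x∣≡K*∣y∣ : ∣ x ∣ ≡ K ℕ.* ∣ y ∣
      ∣x∣≡K*∣y∣ = trans (cong ∣_∣ x≡-Ky) (trans (ℤ.∣-i∣≡∣i∣ (+ K * y)) (ℤ.abs-* (+ K) y))
      K*∣y∣<K*1 : K ℕ.* ∣ y ∣ ℕ.< K ℕ.* 1
      K*∣y∣<K*1 = subst₂ ℕ._<_ ∣x∣≡K*∣y∣ (sym (ℕ.*-identityʳ K)) ∣x∣<K

  dilation-kernelᵥ : ∀ {K} (e f : Vec ℤ n) → ∥ e ∥ ℕ.< K →
                     zipWith _+_ e (Vec.map (+ K *_) f) ≡ 0ᵥ → f ≡ 0ᵥ
  dilation-kernelᵥ []      []      _  _  = refl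
  dilation-kernelᵥ (x ∷ e) (y ∷ f) lt eq = cong₂ _∷_
    (dilation-kernel {x = x} (ℕ.≤-<-trans (ℕ.m≤m+n _ _) lt) (Vec.∷-injectiveˡ eq))
    (dilation-kernelᵥ e f (ℕ.≤-<-trans (ℕ.m≤n+m _ _) lt) (Vec.∷-injectiveʳ eq))

  ctₘ-⊗-dilateₘ : ∀ {K} a (e : Vec ℤ r) b f → ∥ e ∥ ℕ.< K →
                  ctₘ ((a , e) ⊗ dilateₘ K (b , f)) ≡ ctₘ (a , e) * ctₘ (b , f)
  ctₘ-⊗-dilateₘ {K = K} a e b f ∥e∥<K with Vec.≡-dec ℤ._≟_ f 0ᵥ
  ... | yes refl = begin
    ctₘ (a * b , zipWith _+_ e (Vec.map (+ K *_) 0ᵥ))   ≡⟨ cong (λ v → ctₘ (a * b , v)) e+K·0≡e ⟩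
    ctₘ (a * b , e)                                     ≡⟨ cong (λ c → ctₘ (c , e)) (ℤ.*-comm a b) ⟩
    ctₘ (b * a , e)                                     ≡⟨ ctₘ-*ˡ b a e ⟩
    b * ctₘ (a , e)                                     ≡⟨ ℤ.*-comm b _ ⟩
    ctₘ (a , e) * b                                     ∎
    where
      open ≡-Reasoning
      K·0≡0 : Vec.map (+ K *_) 0ᵥ ≡ 0ᵥ {r}
      K·0≡0 = trans (Vec.map-replicate (+ K *_) 0ℤ _) (cong (Vec.replicate _) (ℤ.*-zeroʳ (+ K)))
      e+K·0≡e : zipWith _+_ e (Vec.map (+ K *_) 0ᵥ) ≡ e
      e+K·0≡e = trans (cong (zipWith _+_ e) K·0≡0) (Vec.zipWith-identityʳ ℤ.+-identityʳ e)
  ... | no f≢0 =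
    trans (ctₘ-≢0ᵥ (a * b) (f≢0 ∘ dilation-kernelᵥ e f ∥e∥<K)) (sym (ℤ.*-zeroʳ (ctₘ (a , e))))

  ct-·-dilate : ∀ {K} (A B : Laurent r) → exponentSize A ℕ.< K → ct (A · dilate K B) ≡ ct A * ct B
  ct-·-dilate {K = K} A B size<K = begin
    ct (A · dilate K B)                                 ≡⟨ ct≡∑ctₘ (A · dilate K B) ⟩
    ∑ (A · dilate K B) ctₘ                              ≡⟨ ∑-· A (dilate K B) ctₘ ⟩
    ∑ A (λ a → ∑ (dilate K B) (λ d → ctₘ (a ⊗ d)))      ≡⟨ factor A size<K ⟩
    ∑ A (λ a → ct B * ctₘ a)                            ≡⟨ ∑-*ˡ A (ct B) ctₘ ⟩
    ct B * ∑ A ctₘ                                      ≡⟨ ℤ.*-comm (ct B) _ ⟩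
    ∑ A ctₘ * ct B                                      ≡⟨ cong (_* ct B) (ct≡∑ctₘ A) ⟨
    ct A * ct B                                         ∎
    where
      open ≡-Reasoning
      row : ∀ a e → ∥ e ∥ ℕ.< K → ∑ (dilate K B) (λ d → ctₘ ((a , e) ⊗ d)) ≡ ct B * ctₘ (a , e)
      row a e ∥e∥<K = begin
        ∑ (dilate K B) (λ d → ctₘ ((a , e) ⊗ d))     ≡⟨ ∑-map B (dilateₘ K) _ ⟩
        ∑ B (λ b → ctₘ ((a , e) ⊗ dilateₘ K b))      ≡⟨ ∑-cong B (λ (b , f) → ctₘ-⊗-dilateₘ a e b f ∥e∥<K) ⟩
        ∑ B (λ b → ctₘ (a , e) * ctₘ b)              ≡⟨ ∑-*ˡ B (ctₘ (a , e)) ctₘ ⟩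
        ctₘ (a , e) * ∑ B ctₘ                        ≡⟨ cong (ctₘ (a , e) *_) (ct≡∑ctₘ B) ⟨
        ctₘ (a , e) * ct B                           ≡⟨ ℤ.*-comm _ (ct B) ⟩
        ct B * ctₘ (a , e)                           ∎
      factor : ∀ A → exponentSize A ℕ.< K →
               ∑ A (λ a → ∑ (dilate K B) (λ d → ctₘ (a ⊗ d))) ≡ ∑ A (λ a → ct B * ctₘ a)
      factor []            _  = refl
      factor ((a , e) ∷ A) lt = cong₂ _+_
        (row a e (ℕ.≤-<-trans (ℕ.m≤m+n _ _) lt)) (factor A (ℕ.≤-<-trans (ℕ.m≤n+m _ _) lt))

module Frobenius {r p : ℕ} (pr : Prime p) where
  open import Data.Nat as ℕ using (zero; suc)
  import Data.Nat.Properties as ℕ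
  open import Data.Nat.Primality using (prime⇒nonZero)
  open import Data.Integer as ℤ using (ℤ; +_; _+_; _*_; _%ℕ_)
  import Data.Integer.Properties as ℤ
  open import Data.Integer.Tactic.RingSolver using (solve-∀)
  open import Data.Vec using (Vec)
  open import Data.List using ([]; _∷_; _++_)
  open import Data.Product using (_,_)
  open import Relation.Binary.PropositionalEquality using (_≡_; refl; sym; trans; cong; cong₂)
  open FormalSums
  open IntegerCongruence
  open LaurentModP
  open Dilation

  private instance
    p≢0 = prime⇒nonZero pr

  open CommutativeSemiring (laurentSemiring r p)
    using (semiring; setoid; *-commutativeSemigroup; *-identityʳ; *-congˡ; *-congʳ)
  open import Algebra.Properties.Semiring.Exp semiring
    using (^-congˡ; ^-assocʳ; ^-homo-*) renaming (_^_ to _^ₛ_)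
  open import Algebra.Properties.Semiring.Mult semiring using (_×_)
  open import Algebra.Properties.CommutativeSemigroup *-commutativeSemigroup using (xy∙z≈xz∙y)
  open FreshmansDream (laurentSemiring r p) using (Characteristic; frobenius-+; frobenius-×)
  import Relation.Binary.Reasoning.Setoid setoid as ≈-Reasoning

  ^≡^ₛ : ∀ (A : Laurent r) n → A ^ n ≡ A ^ₛ n
  ^≡^ₛ A zero    = refl
  ^≡^ₛ A (suc n) = cong (A ·_) (^≡^ₛ A n)

  ct-×-· : ∀ n (A C : Laurent r) → ct ((n × A) · C) ≡ + n * ct (A · C)
  ct-×-· zero    A C = sym (ℤ.*-zeroˡ (ct (A · C)))
  ct-×-· (suc n) A C =
    trans (ct-·-++ A (n × A) C) (trans (cong (_+_ (ct (A · C))) (ct-×-· n A C)) (lemma (+ n) _))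
    where lemma : ∀ a x → x + a * x ≡ (+ 1 + a) * x
          lemma = solve-∀

  characteristic : Characteristic p
  characteristic A =
    ≈-mod λ C → ≡-mod-trans (≡-mod-reflexive (ct-×-· p A C)) (m*x≡0-mod (ct (A · C)))

  ct-monomial-· : ∀ (m : Monomial r) C → ct ((m ∷ []) · C) ≡ ∑ C (λ d → ctₘ (m ⊗ d))
  ct-monomial-· m C = trans (ct≡∑ctₘ ((m ∷ []) · C)) (trans (∑-· (m ∷ []) C ctₘ) (ℤ.+-identityʳ _))

  ct-coefficient-· : ∀ c (e : Vec ℤ r) C → ct (((c , e) ∷ []) · C) ≡ c * ct (((+ 1 , e) ∷ []) · C)
  ct-coefficient-· c e C = begin
    ct (((c , e) ∷ []) · C)                   ≡⟨ ct-monomial-· (c , e) C ⟩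
    ∑ C (λ d → ctₘ ((c , e) ⊗ d))             ≡⟨ ∑-cong C pull-out-c ⟩
    ∑ C (λ d → c * ctₘ ((+ 1 , e) ⊗ d))       ≡⟨ ∑-*ˡ C c _ ⟩
    c * ∑ C (λ d → ctₘ ((+ 1 , e) ⊗ d))       ≡⟨ cong (c *_) (ct-monomial-· (+ 1 , e) C) ⟨
    c * ct (((+ 1 , e) ∷ []) · C)             ∎
    where
      open Relation.Binary.PropositionalEquality.≡-Reasoning
      pull-out-c : ∀ d → ctₘ ((c , e) ⊗ d) ≡ c * ctₘ ((+ 1 , e) ⊗ d)
      pull-out-c (b , f) = trans (ctₘ-*ˡ c b _) (cong (λ b → c * ctₘ (b , _)) (sym (ℤ.*-identityˡ b)))

  -- Writing the coefficient as a natural multiple makes frobenius-× applicable.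
  monomial≈ : ∀ c (e : Vec ℤ r) → (c , e) ∷ [] ≈ (c %ℕ p) × ((+ 1 , e) ∷ []) mod p
  monomial≈ c e = ≈-mod λ C → begin
    ct (((c , e) ∷ []) · C)                   ≡⟨ ct-coefficient-· c e C ⟩
    c * ct (((+ 1 , e) ∷ []) · C)             ≈⟨ *-congʳ-mod _ (≡-mod-%ℕ c) ⟩
    + (c %ℕ p) * ct (((+ 1 , e) ∷ []) · C)    ≡⟨ ct-×-· (c %ℕ p) _ C ⟨
    ct (((c %ℕ p) × ((+ 1 , e) ∷ [])) · C)    ∎
    where open ≡-mod-Reasoning p

  frobenius-monomial : ∀ c (e : Vec ℤ r) → ((c , e) ∷ []) ^ p ≈ dilate p ((c , e) ∷ []) mod p
  frobenius-monomial c e = begin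
    ((c , e) ∷ []) ^ p                      ≡⟨ ^≡^ₛ _ p ⟩
    ((c , e) ∷ []) ^ₛ p                     ≈⟨ ^-congˡ p (monomial≈ c e) ⟩
    (n × ((+ 1 , e) ∷ [])) ^ₛ p             ≈⟨ frobenius-× pr characteristic n _ ⟩
    n × ((+ 1 , e) ∷ []) ^ₛ p               ≡⟨ cong (n ×_) (^≡^ₛ _ p) ⟨
    n × ((+ 1 , e) ∷ []) ^ p                ≡⟨ cong (n ×_) (monomial-^ (+ 1) e p) ⟩
    n × dilate p (((+ 1) ℤ.^ p , e) ∷ [])   ≡⟨ cong (λ a → n × dilate p ((a , e) ∷ [])) (ℤ.^-zeroˡ p) ⟩
    n × dilate p ((+ 1 , e) ∷ [])           ≈⟨ monomial≈ c _ ⟨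
    dilate p ((c , e) ∷ [])                 ∎
    where
      open ≈-Reasoning
      n = c %ℕ p

  frobenius : ∀ (A : Laurent r) → A ^ p ≈ dilate p A mod p
  frobenius []            = ≈-trans (≡⇒≈ (^≡^ₛ [] p)) (frobenius-× pr characteristic 0 one)
  frobenius ((c , e) ∷ A) = begin
    ((c , e) ∷ A) ^ p                    ≡⟨ ^≡^ₛ _ p ⟩
    ((c , e) ∷ A) ^ₛ p                   ≈⟨ frobenius-+ pr characteristic ((c , e) ∷ []) A ⟩
    ((c , e) ∷ []) ^ₛ p ++ A ^ₛ p        ≡⟨ cong₂ _++_ (^≡^ₛ _ p) (^≡^ₛ A p) ⟨
    ((c , e) ∷ []) ^ p ++ A ^ p          ≈⟨ ++-cong-≈ (frobenius-monomial c e) (frobenius A) ⟩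
    dilate p ((c , e) ∷ A)               ∎
    where open ≈-Reasoning

  frobenius-iterated : ∀ k (A : Laurent r) → A ^ (p ℕ.^ k) ≈ dilate (p ℕ.^ k) A mod p
  frobenius-iterated zero    A = ≈-trans (*-identityʳ A) (≡⇒≈ (sym (dilate-1 A)))
  frobenius-iterated (suc k) A = begin
    A ^ (p ℕ.* K)              ≡⟨ trans (cong (A ^_) (ℕ.*-comm p K)) (^≡^ₛ A (K ℕ.* p)) ⟩
    A ^ₛ (K ℕ.* p)             ≈⟨ ^-assocʳ A K p ⟨
    (A ^ₛ K) ^ₛ p              ≈⟨ ^-congˡ p (≈-trans (≡⇒≈ (sym (^≡^ₛ A K))) (frobenius-iterated k A)) ⟩
    dilate K A ^ₛ p            ≡⟨ ^≡^ₛ (dilate K A) p ⟨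
    dilate K A ^ p             ≈⟨ frobenius (dilate K A) ⟩
    dilate p (dilate K A)      ≡⟨ dilate-dilate p K A ⟩
    dilate (p ℕ.* K) A         ∎
    where
      open ≈-Reasoning
      K = p ℕ.^ k

  ^-split-dilate : ∀ (P Q : Laurent r) n m k →
                   (P ^ (n ℕ.+ m ℕ.* p ℕ.^ k)) · Q ≈ ((P ^ n) · Q) · dilate (p ℕ.^ k) (P ^ m) mod p
  ^-split-dilate P Q n m k = begin
    (P ^ (n ℕ.+ m ℕ.* K)) · Q              ≡⟨ cong (_· Q) (^≡^ₛ P (n ℕ.+ m ℕ.* K)) ⟩
    (P ^ₛ (n ℕ.+ m ℕ.* K)) · Q             ≈⟨ *-congʳ (^-homo-* P n (m ℕ.* K)) ⟩
    ((P ^ₛ n) · (P ^ₛ (m ℕ.* K))) · Q      ≈⟨ xy∙z≈xz∙y (P ^ₛ n) (P ^ₛ (m ℕ.* K)) Q ⟩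
    ((P ^ₛ n) · Q) · (P ^ₛ (m ℕ.* K))      ≈⟨ *-congˡ {(P ^ₛ n) · Q} (^-assocʳ P m K) ⟨
    ((P ^ₛ n) · Q) · ((P ^ₛ m) ^ₛ K)       ≡⟨ cong₂ (λ A B → (A · Q) · (B ^ₛ K)) (^≡^ₛ P n) (^≡^ₛ P m) ⟨
    ((P ^ n) · Q) · ((P ^ m) ^ₛ K)         ≡⟨ cong (((P ^ n) · Q) ·_) (^≡^ₛ (P ^ m) K) ⟨
    ((P ^ n) · Q) · ((P ^ m) ^ K)          ≈⟨ *-congˡ {(P ^ n) · Q} (frobenius-iterated k (P ^ m)) ⟩
    ((P ^ n) · Q) · dilate K (P ^ m)       ∎
    where
      open ≈-Reasoning
      K = p ℕ.^ k

  ct-^-factor : ∀ (P Q : Laurent r) n m k → exponentSize ((P ^ n) · Q) ℕ.< p ℕ.^ k →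
                ct ((P ^ (n ℕ.+ m ℕ.* p ℕ.^ k)) · Q) ≡ ct ((P ^ n) · Q) * ct (P ^ m) mod p
  ct-^-factor P Q n m k size<p^k = begin
    ct ((P ^ (n ℕ.+ m ℕ.* p ℕ.^ k)) · Q)             ≈⟨ ct-cong-≈ (^-split-dilate P Q n m k) ⟩
    ct (((P ^ n) · Q) · dilate (p ℕ.^ k) (P ^ m))    ≡⟨ ct-·-dilate ((P ^ n) · Q) (P ^ m) size<p^k ⟩
    ct ((P ^ n) · Q) * ct (P ^ m)                    ∎
    where open ≡-mod-Reasoning p

module Fermat where
  open import Data.Nat as ℕ using (zero; suc)
  open import Data.Nat.Primality using (¬prime[0])
  open import Data.Integer as ℤ using (+_; 1ℤ)
  import Data.Integer.Properties as ℤ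
  open import Data.Integer.Divisibility.Signed using (_∣_)
  open import Data.Vec using ([])
  open import Data.List using ([]; _∷_)
  open import Data.Product using (_,_)
  open import Data.Empty using (⊥-elim)
  open import Relation.Nullary using (¬_)
  open import Relation.Binary.PropositionalEquality using (sym; cong)
  open IntegerCongruence
  open LaurentModP
  open Dilation

  -- Frobenius for a constant Laurent polynomial in zero variables.
  ^p≡id : ∀ {p} → Prime p → ∀ c → c ℤ.^ p ≡ c mod p
  ^p≡id {p} pr c = begin
    c ℤ.^ p                      ≡⟨ ℤ.+-identityʳ _ ⟨
    ct ((c ℤ.^ p , []) ∷ [])     ≡⟨ cong ct (monomial-^ c [] p) ⟨
    ct (((c , []) ∷ []) ^ p)     ≈⟨ ct-cong-≈ (Frobenius.frobenius pr ((c , []) ∷ [])) ⟩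
    ct ((c , []) ∷ [])           ≡⟨ ℤ.+-identityʳ c ⟩
    c                            ∎
    where open ≡-mod-Reasoning p

  fermat-little : ∀ {p c} → Prime p → ¬ (+ p ∣ c) → c ℤ.^ (p ℕ.∸ 1) ≡ 1ℤ mod p
  fermat-little {zero}      pr _   = ⊥-elim (¬prime[0] pr)
  fermat-little {suc _} {c} pr p∤c =
    prime-*-cancelˡ pr p∤c (≡-mod-trans (^p≡id pr c) (≡-mod-reflexive (sym (ℤ.*-identityʳ c))))

open import Data.Nat using (_<_)
open import Data.Nat.Primality using (prime⇒nonZero)
open import Data.Integer using (+_)
open import Data.Integer.Divisibility using (_∣_)
open import Data.Product using (_×_; ∃-syntax; _,_)
open import Relation.Nullary using (¬_)

module Recurrence {r p} (pr : Prime p) (P : Laurent r) {n₀} (0<n₀ : 0 < n₀)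
                  (p∤c : ¬ (+ p ∣ ct (P ^ n₀))) where
  open import Data.Nat as ℕ using (zero; suc; _∸_; _+_)
  import Data.Nat.Properties as ℕ
  open import Data.Nat.Base using (nonTrivial⇒n>1)
  open import Data.Nat.Primality using (prime⇒nonTrivial)
  open import Data.Integer as ℤ using (1ℤ; _*_)
  import Data.Integer.Properties as ℤ
  open import Data.Integer.Divisibility.Signed using (∣⇒∣ᵤ)
  open import Function using (_∘_)
  open import Relation.Binary.PropositionalEquality using (_≡_; sym; cong; subst)
  open import Algebra.Properties.CommutativeSemigroup ℕ.+-commutativeSemigroup using (xy∙z≈xz∙y)
  open FormalSums
  open IntegerCongruence
  open Dilation
  open Frobenius {r} pr using (ct-^-factor)
  open Fermat using (fermat-little)
  open NatBounds

  private
    instance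
      p≢0 = prime⇒nonZero pr
    1<p = nonTrivial⇒n>1 p {{prime⇒nonTrivial pr}}
    c = ct (P ^ n₀)

  ct-^-·-one : ∀ n → ct ((P ^ n) · one) ≡ ct (P ^ n)
  ct-^-·-one n = ct-cong-≋ (·-identityʳ-≋ (P ^ n))

  ct-^≡c^ : ∀ t → ∃[ m ] (0 < m × ct (P ^ m) ≡ c ℤ.^ suc t mod p)
  ct-^≡c^ zero    = n₀ , 0<n₀ , ≡-mod-reflexive (sym (ℤ.*-identityʳ c))
  ct-^≡c^ (suc t) with ct-^≡c^ t
  ... | m , _ , ct≡c^ = n₀ + m ℕ.* p ℕ.^ k , ℕ.<-≤-trans 0<n₀ (ℕ.m≤m+n n₀ _) , (begin
    ct (P ^ (n₀ + m ℕ.* p ℕ.^ k))            ≡⟨ ct-^-·-one (n₀ + m ℕ.* p ℕ.^ k) ⟨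
    ct ((P ^ (n₀ + m ℕ.* p ℕ.^ k)) · one)    ≈⟨ ct-^-factor P one n₀ m k (n<m^n 1<p k) ⟩
    ct ((P ^ n₀) · one) * ct (P ^ m)         ≡⟨ cong (_* ct (P ^ m)) (ct-^-·-one n₀) ⟩
    c * ct (P ^ m)                           ≈⟨ *-congˡ-mod c ct≡c^ ⟩
    c * c ℤ.^ suc t                          ∎)
    where
      open ≡-mod-Reasoning p
      k = exponentSize ((P ^ n₀) · one)

  ct-^≡1 : ∃[ m ] (0 < m × ct (P ^ m) ≡ 1ℤ mod p)
  ct-^≡1 with ct-^≡c^ (p ∸ 2)
  ... | m , 0<m , ct≡c^ = m , 0<m , ≡-mod-trans ct≡c^ c^[p∸1]≡1
    where
      c^[p∸1]≡1 : c ℤ.^ suc (p ∸ 2) ≡ 1ℤ mod p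
      c^[p∸1]≡1 = subst (λ t → c ℤ.^ t ≡ 1ℤ mod p) (ℕ.+-∸-assoc 1 1<p) (fermat-little pr (p∤c ∘ ∣⇒∣ᵤ))

  window-recurs : ∀ (Q : Laurent r) i ℓ → ∃[ j ] (0 < j ×
                  (∀ k → k < ℓ → ct ((P ^ (i + k)) · Q) ≡ ct ((P ^ (i + j + k)) · Q) mod p))
  window-recurs Q i ℓ with ct-^≡1
  ... | m , 0<m , ct≡1 = m ℕ.* p ℕ.^ D , ℕ.*-mono-≤ 0<m (ℕ.m^n>0 p D) , λ k k<ℓ → begin
    ct ((P ^ (i + k)) · Q)                    ≡⟨ ℤ.*-identityʳ _ ⟨
    ct ((P ^ (i + k)) · Q) * 1ℤ               ≈⟨ *-congˡ-mod (ct ((P ^ (i + k)) · Q)) ct≡1 ⟨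
    ct ((P ^ (i + k)) · Q) * ct (P ^ m)       ≈⟨ ct-^-factor P Q (i + k) m D (bound k k<ℓ) ⟨
    ct ((P ^ (i + k + m ℕ.* p ℕ.^ D)) · Q)    ≡⟨ cong (λ n → ct ((P ^ n) · Q)) (xy∙z≈xz∙y i k _) ⟩
    ct ((P ^ (i + m ℕ.* p ℕ.^ D + k)) · Q)    ∎
    where
      open ≡-mod-Reasoning p
      size : ℕ → ℕ
      size n = exponentSize ((P ^ n) · Q)
      D = supBelow size (i + ℓ)
      bound : ∀ k → k < ℓ → size (i + k) < p ℕ.^ D
      bound k k<ℓ = ℕ.≤-<-trans (≤-supBelow size (ℕ.+-monoʳ-< i k<ℓ)) (n<m^n 1<p D)

proposition19 : (r : ℕ) (P Q : Laurent r) (p : ℕ) (pr : Prime p) →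
    ∃[ n₀ ] (0 < n₀ × ¬ (+ p ∣ ct (P ^ n₀))) →
    Recurrent (λ n → modPrime (ct ((P ^ n) · Q)) p pr)
proposition19 r P Q p pr (n₀ , 0<n₀ , p∤c) i ℓ =
  let j , 0<j , window = Recurrence.window-recurs pr P 0<n₀ p∤c Q i ℓ
  in  j , 0<j , λ k k<ℓ → IntegerCongruence.%ℕ-cong {{prime⇒nonZero pr}} (window k k<ℓ)
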